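{- Let $p=x^3+ax^2+bx+c\in\mathbb{Q}[x]$ be a cubic Galois polynomial with roots $x_1,x_2,x_3$ enumerated in some order, and let $q=\alpha x^2+\beta x+\gamma\in\mathbb{Q}[x]$ be the unique polynomial of degree at most $2$ with $q(x_1)=x_2$, $q(x_2)=x_3$, $q(x_3)=x_1$. Then $\alpha\neq 0$, i.e. $q$ has degree exactly $2$.
   Context: A cubic Galois polynomial is an irreducible cubic polynomial with rational coefficients whose Galois group over $\mathbb{Q}$ is the cyclic group $A_3$ (its roots are real and its discriminant is a square of a rational number). -}

module Defs where

open import Level using (Level; _⊔_)
open import Data.Nat using (ℕ; zero; suc; _∸_)
open import Data.Integer using (+_)
open import Data.List using (List; []; _∷_; length)
open import Data.Product using (Σ; _×_; ∃; ∃-syntax; _,_)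
open import Relation.Nullary using (¬_)
open import Relation.Binary.PropositionalEquality using (_≡_; _≢_)
open import Data.Rational using (ℚ; 0ℚ; 1ℚ)
import Data.Rational as ℚ
open import Data.Rational.Properties using (+-*-commutativeRing)
open import Algebra.Bundles using (CommutativeRing; RawRing)
open import Algebra.Morphism.Structures using (IsRingHomomorphism)

-- Polynomials over ℚ as little-endian coefficient lists
-- (the i-th entry is the coefficient of x^i).

Poly : Set
Poly = List ℚ

coeff : Poly → ℕ → ℚ
coeff []       _       = 0ℚ
coeff (a ∷ f)  zero    = a
coeff (a ∷ f)  (suc k) = coeff f k

private
  convSum : Poly → Poly → ℕ → ℕ → ℚ
  convSum f g k zero    = coeff f 0 ℚ.* coeff g k
  convSum f g k (suc n) = convSum f g k n ℚ.+ coeff f (suc n) ℚ.* coeff g (k ∸ suc n)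

mulCoeff : Poly → Poly → ℕ → ℚ
mulCoeff f g k = convSum f g k k

HasDegree : Poly → ℕ → Set
HasDegree f d = (length f ≡ suc d) × (coeff f d ≢ 0ℚ)

-- f is irreducible in ℚ[x]: f is non-constant (degree ≥ 1) and is not a
-- product of two polynomials of degree ≥ 1 (the units of ℚ[x] being the
-- nonzero constants).
Irreducible : Poly → Set
Irreducible f =
  (∃[ d ] HasDegree f (suc d)) ×
  ¬ (∃[ g ] ∃[ h ] ∃[ d ] ∃[ e ]
       HasDegree g (suc d) × HasDegree h (suc e) ×
       (∀ k → mulCoeff g h k ≡ coeff f k))

cubic : ℚ → ℚ → ℚ → Poly
cubic a b c = c ∷ b ∷ a ∷ 1ℚ ∷ []

private
  lit : ℕ → ℚ
  lit n = (+ n) ℚ./ 1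

discriminant : ℚ → ℚ → ℚ → ℚ
discriminant a b c =
  a ℚ.* a ℚ.* b ℚ.* b ℚ.- lit 4 ℚ.* b ℚ.* b ℚ.* b ℚ.- lit 4 ℚ.* a ℚ.* a ℚ.* a ℚ.* c
  ℚ.- lit 27 ℚ.* c ℚ.* c ℚ.+ lit 18 ℚ.* a ℚ.* b ℚ.* c

-- Cubic Galois polynomial: irreducible over ℚ with square discriminant
-- (Galois group A₃; the roots are then automatically real).
IsCubicGalois : ℚ → ℚ → ℚ → Set
IsCubicGalois a b c =
  Irreducible (cubic a b c) × (∃[ δ ] δ ℚ.* δ ≡ discriminant a b c)

IsField : ∀ {c ℓ} → CommutativeRing c ℓ → Set (c ⊔ ℓ)
IsField K = ¬ (1# ≈ 0#) × (∀ x → ¬ (x ≈ 0#) → ∃[ y ] (x * y ≈ 1#))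
  where open CommutativeRing K

IsℚEmbedding : ∀ {c ℓ} (K : CommutativeRing c ℓ) → (ℚ → CommutativeRing.Carrier K) → Set ℓ
IsℚEmbedding K ι =
  IsRingHomomorphism (CommutativeRing.rawRing +-*-commutativeRing)
                     (CommutativeRing.rawRing K) ι

eval : ∀ {c ℓ} (K : CommutativeRing c ℓ) → (ℚ → CommutativeRing.Carrier K) →
       Poly → CommutativeRing.Carrier K → CommutativeRing.Carrier K
eval K ι []      y = CommutativeRing.0# K
eval K ι (a ∷ f) y = ι a + y * eval K ι f y
  where open CommutativeRing K

-- x₁, x₂, x₃ are the roots of p (with multiplicity, in this order):
-- p(y) = (y − x₁)(y − x₂)(y − x₃) for all y ∈ K.
AreRootsOf : ∀ {c ℓ} (K : CommutativeRing c ℓ) → (ℚ → CommutativeRing.Carrier K) →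
             Poly → (x₁ x₂ x₃ : CommutativeRing.Carrier K) → Set (c ⊔ ℓ)
AreRootsOf K ι p x₁ x₂ x₃ =
  ∀ y → eval K ι p y ≈ (y - x₁) * (y - x₂) * (y - x₃)
  where open CommutativeRing K

quadratic : ℚ → ℚ → ℚ → Poly
quadratic α β γ = γ ∷ β ∷ α ∷ []

-- If α = 0, then q is an affine map y ↦ γ + βy permuting the roots cyclically, so x₁ is
-- fixed by its third iterate: (1 + β + β²)((1 − β)x₁ − γ) = 0. Over ℚ, 1 + β + β² ≠ 0
-- (it is ((1 + 2β)² + 3)/4), hence (1 − β)x₁ = γ. For β ≠ 1 this makes x₁ = γ/(1 − β)
-- rational; for β = 1 it forces γ = 0, so the three roots coincide and x₁ = −a/3 by
-- Vieta. Either way the cubic has a rational root, contradicting irreducibility.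
module Submission where

open import Defs
open import Data.Rational using (ℚ; 0ℚ; 1ℚ)
open import Relation.Binary.PropositionalEquality using (_≢_)
open import Algebra.Bundles using (CommutativeRing)

open import Algebra.Morphism.Structures using (IsRingHomomorphism)
open import Algebra.Solver.Ring.AlmostCommutativeRing
  using (fromCommutativeRing; _-Raw-AlmostCommutative⟶_)
import Algebra.Solver.Ring
open import Data.Integer using (+_)
open import Data.List using ([]; _∷_)
open import Data.Maybe using (Maybe)
import Data.Maybe as Maybe
open import Data.Nat using (ℕ; zero; suc; _∸_)
import Data.Nat as ℕ
open import Data.Product using (∃; _,_)
import Data.Rational as ℚ
import Data.Rational.Properties as ℚ
open import Data.Rational.Solver using (module +-*-Solver)
open import Data.Sum using (inj₁; inj₂)
open import Function using (id; _∘_)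
open import Relation.Binary.PropositionalEquality
  using (_≡_; refl; cong; cong₂; subst; module ≡-Reasoning)
open import Relation.Nullary using (¬_; yes; no; contradiction)
open import Relation.Nullary.Decidable using (dec⇒maybe)
open import Algebra.Properties.Group ℚ.+-0-group using () renaming (x∙y⁻¹≈ε⇒x≈y to p-q≡0⇒p≡q)

-- `Defs` keeps the convolution sum behind `mulCoeff` private. Abstracting `suc k` and `_+_`
-- in the unfolded `mulCoeff f g (suc k)` exposes it applied to distinct variables, so
-- unification solves the meta `convolution` with it, and its equations then hold by `refl`.
mutual
  convolution : Poly → Poly → ℕ → ℕ → ℚ
  convolution = _

  private
    mulCoeff-suc : ∀ f g k →
      mulCoeff f g (suc k) ≡ convolution f g (suc k) k ℚ.+ coeff f (suc k) ℚ.* coeff g (k ∸ k)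
    mulCoeff-suc f g k with suc k | ℚ._+_
    ... | _ | _ = refl

convolution-linear-quadratic : ∀ {u v a₀ a₁ a₂} k n →
  convolution (u ∷ v ∷ []) (a₀ ∷ a₁ ∷ a₂ ∷ []) (4 ℕ.+ k) n ≡ 0ℚ
convolution-linear-quadratic {u} k zero = ℚ.*-zeroʳ u
convolution-linear-quadratic {u} {v} {a₀} {a₁} {a₂} k (suc n) =
  cong₂ ℚ._+_ (convolution-linear-quadratic k n) (high-term n)
  where
  high-term : ∀ n → coeff (u ∷ v ∷ []) (suc n) ℚ.* coeff (a₀ ∷ a₁ ∷ a₂ ∷ []) (4 ℕ.+ k ∸ suc n) ≡ 0ℚ
  high-term zero    = ℚ.*-zeroʳ v
  high-term (suc n) = ℚ.*-zeroˡ (coeff (a₀ ∷ a₁ ∷ a₂ ∷ []) (suc (suc k) ∸ n))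

evalℚ : Poly → ℚ → ℚ
evalℚ = eval ℚ.+-*-commutativeRing id

root⇒¬irreducible : ∀ {a b c} r → evalℚ (cubic a b c) r ≡ 0ℚ → ¬ Irreducible (cubic a b c)
root⇒¬irreducible {a} {b} {c} r root (_ , noFactorisation) =
  noFactorisation (linear , quotient , 0 , 1 , (refl , λ ()) , (refl , λ ()) , coefficients)
  where
  open +-*-Solver
  open ≡-Reasoning
  linear quotient : Poly
  linear   = ℚ.- r ∷ 1ℚ ∷ []
  quotient = b ℚ.+ r ℚ.* (a ℚ.+ r) ∷ a ℚ.+ r ∷ 1ℚ ∷ []
  coefficients : ∀ k → mulCoeff linear quotient k ≡ coeff (cubic a b c) k
  coefficients 0 = begin
    ℚ.- r ℚ.* (b ℚ.+ r ℚ.* (a ℚ.+ r))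
      ≡⟨ solve 4 (λ r a b c → :- r :* (b :+ r :* (a :+ r))
                            := c :- (c :+ r :* (b :+ r :* (a :+ r :* (con 1ℚ :+ r :* con 0ℚ)))))
                 refl r a b c ⟩
    c ℚ.- evalℚ (cubic a b c) r  ≡⟨ cong (λ e → c ℚ.- e) root ⟩
    c ℚ.- 0ℚ                    ≡⟨ ℚ.+-identityʳ c ⟩
    c                           ∎
  coefficients 1 =
    solve 3 (λ r a b → :- r :* (a :+ r) :+ con 1ℚ :* (b :+ r :* (a :+ r)) := b) refl r a b
  coefficients 2 =
    solve 3 (λ r a b → :- r :* con 1ℚ :+ con 1ℚ :* (a :+ r) :+ con 0ℚ :* (b :+ r :* (a :+ r)) := a)
            refl r a b
  coefficients 3 =
    solve 3 (λ r a b → :- r :* con 0ℚ :+ con 1ℚ :* con 1ℚ :+ con 0ℚ :* (a :+ r)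
                       :+ con 0ℚ :* (b :+ r :* (a :+ r)) := con 1ℚ)
            refl r a b
  coefficients (suc (suc (suc (suc k)))) = convolution-linear-quadratic k (4 ℕ.+ k)

square-nonNegative : ∀ p → ℚ.NonNegative (p ℚ.* p)
square-nonNegative p with ℚ.≤-total 0ℚ p
... | inj₁ 0≤p = ℚ.nonNeg*nonNeg⇒nonNeg p {{ℚ.nonNegative 0≤p}} p {{ℚ.nonNegative 0≤p}}
... | inj₂ p≤0 = ℚ.nonPos*nonPos⇒nonPos p {{ℚ.nonPositive p≤0}} p {{ℚ.nonPositive p≤0}}

1+p+p²≢0 : ∀ p → 1ℚ ℚ.+ p ℚ.+ p ℚ.* p ≢ 0ℚ
1+p+p²≢0 p 1+p+p²≡0 =
  -3-nonNegative (subst ℚ.NonNegative [1+2p]²≡-3 (square-nonNegative (1ℚ ℚ.+ p ℚ.+ p)))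
  where
  open +-*-Solver
  open ≡-Reasoning
  4ℚ -3ℚ : ℚ
  4ℚ  = + 4 ℚ./ 1
  -3ℚ = ℚ.- (+ 3 ℚ./ 1)
  -3-nonNegative : ¬ ℚ.NonNegative -3ℚ
  -3-nonNegative ()
  [1+2p]²≡-3 : (1ℚ ℚ.+ p ℚ.+ p) ℚ.* (1ℚ ℚ.+ p ℚ.+ p) ≡ -3ℚ
  [1+2p]²≡-3 = begin
    (1ℚ ℚ.+ p ℚ.+ p) ℚ.* (1ℚ ℚ.+ p ℚ.+ p)
      ≡⟨ solve 1 (λ p → (con 1ℚ :+ p :+ p) :* (con 1ℚ :+ p :+ p)
                      := con 4ℚ :* (con 1ℚ :+ p :+ p :* p) :+ con -3ℚ) refl p ⟩
    4ℚ ℚ.* (1ℚ ℚ.+ p ℚ.+ p ℚ.* p) ℚ.+ -3ℚ  ≡⟨ cong (λ s → 4ℚ ℚ.* s ℚ.+ -3ℚ) 1+p+p²≡0 ⟩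
    -3ℚ                                  ∎

⅓ : ℚ
⅓ = + 1 ℚ./ 3

module _ {c ℓ} (K : CommutativeRing c ℓ) {ι : ℚ → CommutativeRing.Carrier K}
         (ι-hom : IsℚEmbedding K ι) where
  open CommutativeRing K renaming (refl to ≈-refl)
  open IsRingHomomorphism ι-hom
  open import Relation.Binary.Reasoning.Setoid setoid
  open import Algebra.Properties.Group +-group using (x∙y⁻¹≈ε⇒x≈y; x≈y⇒x∙y⁻¹≈ε)

  private
    ℚ⟶K : CommutativeRing.rawRing ℚ.+-*-commutativeRing
            -Raw-AlmostCommutative⟶ fromCommutativeRing K
    ℚ⟶K = record
      { ⟦_⟧ = ι ; +-homo = +-homo ; *-homo = *-homo ; -‿homo = -‿homo
      ; 0-homo = 0#-homo ; 1-homo = 1#-homo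
      }

    ι-≟ : ∀ p q → Maybe (ι p ≈ ι q)
    ι-≟ p q = Maybe.map ⟦⟧-cong (dec⇒maybe (p ℚ.≟ q))

    open Algebra.Solver.Ring _ _ ℚ⟶K ι-≟
      using (Polynomial; solve; _:=_; con; _:+_; _:-_; _:*_; :-_)

  ι-unscale : ∀ z .{{_ : ℚ.NonZero z}} x → x ≈ ι (ℚ.1/ z) * (ι z * x)
  ι-unscale z x = begin
    x                        ≈⟨ *-identityˡ x ⟨
    1# * x                   ≈⟨ *-congʳ 1#-homo ⟨
    ι 1ℚ * x                 ≈⟨ *-congʳ (⟦⟧-cong (ℚ.*-inverseˡ z)) ⟨
    ι (ℚ.1/ z ℚ.* z) * x     ≈⟨ *-congʳ (*-homo _ z) ⟩
    ι (ℚ.1/ z) * ι z * x     ≈⟨ *-assoc _ _ x ⟩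
    ι (ℚ.1/ z) * (ι z * x)   ∎

  ι-divide : ∀ z .{{_ : ℚ.NonZero z}} {w x} → ι z * x ≈ ι w → ι (ℚ.1/ z ℚ.* w) ≈ x
  ι-divide z {w} {x} zx≈w = begin
    ι (ℚ.1/ z ℚ.* w)         ≈⟨ *-homo _ w ⟩
    ι (ℚ.1/ z) * ι w         ≈⟨ *-congˡ zx≈w ⟨
    ι (ℚ.1/ z) * (ι z * x)   ≈⟨ ι-unscale z x ⟨
    x                        ∎

  ι-cancel-zero : ∀ z .{{_ : ℚ.NonZero z}} {x} → ι z * x ≈ 0# → x ≈ 0#
  ι-cancel-zero z {x} zx≈0 = begin
    x                        ≈⟨ ι-unscale z x ⟩
    ι (ℚ.1/ z) * (ι z * x)   ≈⟨ *-congˡ zx≈0 ⟩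
    ι (ℚ.1/ z) * 0#          ≈⟨ zeroʳ _ ⟩
    0#                       ∎

  ι≈0⇒≡0 : 1# ≉ 0# → ∀ z → ι z ≈ 0# → z ≡ 0ℚ
  ι≈0⇒≡0 1≉0 z ιz≈0 with z ℚ.≟ 0ℚ
  ... | yes z≡0 = z≡0
  ... | no  z≢0 =
    contradiction (ι-cancel-zero z {{ℚ.≢-nonZero z≢0}} (trans (*-identityʳ (ι z)) ιz≈0)) 1≉0

  eval-ι : ∀ f y → eval K ι f (ι y) ≈ ι (evalℚ f y)
  eval-ι []      y = sym 0#-homo
  eval-ι (q ∷ f) y = begin
    ι q + ι y * eval K ι f (ι y)   ≈⟨ +-congˡ (*-congˡ (eval-ι f y)) ⟩
    ι q + ι y * ι (evalℚ f y)      ≈⟨ +-congˡ (*-homo y _) ⟨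
    ι q + ι (y ℚ.* evalℚ f y)      ≈⟨ +-homo q _ ⟨
    ι (evalℚ (q ∷ f) y)            ∎

  x+y*0≈x : ∀ x y → x + y * 0# ≈ x
  x+y*0≈x x y = trans (+-congˡ (zeroʳ y)) (+-identityʳ x)

  eval-cubic : ∀ a b c y → eval K ι (cubic a b c) y ≈ ι c + y * (ι b + y * (ι a + y * ι 1ℚ))
  eval-cubic a b c y =
    +-congˡ (*-congˡ (+-congˡ (*-congˡ (+-congˡ (*-congˡ (x+y*0≈x (ι 1ℚ) y))))))

  affine-step : ∀ {β γ x y} → eval K ι (quadratic 0ℚ β γ) x ≈ y → y ≈ ι γ + x * ι β
  affine-step {β} {γ} {x} q =
    trans (sym q) (+-congˡ (*-congˡ (trans (+-congˡ higher-terms) (+-identityʳ (ι β)))))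
    where
    higher-terms : x * (ι 0ℚ + x * 0#) ≈ 0#
    higher-terms = trans (*-congˡ (trans (x+y*0≈x (ι 0ℚ) x) 0#-homo)) (zeroʳ x)

  -- For a cubic, f(1) + f(−1) − 2f(0) is twice the coefficient of y².
  second-difference : (Carrier → Carrier) → Carrier
  second-difference f = f (ι 1ℚ) + f (ι (ℚ.- 1ℚ)) - (f (ι 0ℚ) + f (ι 0ℚ))

  second-difference-cong : ∀ {f g} → (∀ y → f y ≈ g y) → second-difference f ≈ second-difference g
  second-difference-cong f≈g = +-cong (+-cong (f≈g _) (f≈g _)) (-‿cong (+-cong (f≈g _) (f≈g _)))

  private
    second-differenceₚ : ∀ {n} → (Polynomial n → Polynomial n) → Polynomial n
    second-differenceₚ f = f (con 1ℚ) :+ f (con (ℚ.- 1ℚ)) :- (f (con 0ℚ) :+ f (con 0ℚ))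

  roots-sum : ∀ {a b c x₁ x₂ x₃} → AreRootsOf K ι (cubic a b c) x₁ x₂ x₃ → x₁ + x₂ + x₃ ≈ - ι a
  roots-sum {a} {b} {c} {x₁} {x₂} {x₃} roots = begin
    x₁ + x₂ + x₃
      ≈⟨ solve 3 (λ x₁ x₂ x₃ →
                    x₁ :+ x₂ :+ x₃
                 := con ℚ.-½ :* second-differenceₚ (λ y → (y :- x₁) :* (y :- x₂) :* (y :- x₃)))
                 ≈-refl x₁ x₂ x₃ ⟩
    ι ℚ.-½ * second-difference (λ y → (y - x₁) * (y - x₂) * (y - x₃))
      ≈⟨ *-congˡ (second-difference-cong (λ y → trans (sym (roots y)) (eval-cubic a b c y))) ⟩
    ι ℚ.-½ * second-difference (λ y → ι c + y * (ι b + y * (ι a + y * ι 1ℚ)))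
      ≈⟨ solve 3 (λ a b c →
                    con ℚ.-½ :* second-differenceₚ (λ y → c :+ y :* (b :+ y :* (a :+ y :* con 1ℚ)))
                 := :- a)
                 ≈-refl (ι a) (ι b) (ι c) ⟩
    - ι a
      ∎

  affine-3-cycle : ∀ {B G x y z} → y ≈ G + x * B → z ≈ G + y * B → x ≈ G + z * B →
                   (ι 1ℚ + B + B * B) * ((ι 1ℚ - B) * x - G) ≈ 0#
  affine-3-cycle {B} {G} {x} xy yz zx = begin
    (ι 1ℚ + B + B * B) * ((ι 1ℚ - B) * x - G)
      ≈⟨ solve 3 (λ B G x → (con 1ℚ :+ B :+ B :* B) :* ((con 1ℚ :- B) :* x :- G)
                          := x :- (G :+ (G :+ (G :+ x :* B) :* B) :* B))
                 ≈-refl B G x ⟩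
    x - (G + (G + (G + x * B) * B) * B)  ≈⟨ +-congˡ (-‿cong third-iterate) ⟨
    x - x                                ≈⟨ -‿inverseʳ x ⟩
    0#                                   ∎
    where
    third-iterate : x ≈ G + (G + (G + x * B) * B) * B
    third-iterate = trans zx (+-congˡ (*-congʳ (trans yz (+-congˡ (*-congʳ xy)))))

  affine-3-cycle⇒linear : ∀ {β γ x y z} →
    y ≈ ι γ + x * ι β → z ≈ ι γ + y * ι β → x ≈ ι γ + z * ι β → ι (1ℚ ℚ.- β) * x ≈ ι γ
  affine-3-cycle⇒linear {β} {γ} {x} xy yz zx =
    x∙y⁻¹≈ε⇒x≈y _ _ (ι-cancel-zero (1ℚ ℚ.+ β ℚ.+ β ℚ.* β) {{ℚ.≢-nonZero (1+p+p²≢0 β)}}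
      (trans (*-cong ι[1+β+β²] (+-congʳ (*-congʳ ι[1-β]))) (affine-3-cycle xy yz zx)))
    where
    ι[1+β+β²] : ι (1ℚ ℚ.+ β ℚ.+ β ℚ.* β) ≈ ι 1ℚ + ι β + ι β * ι β
    ι[1+β+β²] = trans (+-homo _ _) (+-cong (+-homo 1ℚ β) (*-homo β β))
    ι[1-β] : ι (1ℚ ℚ.- β) ≈ ι 1ℚ - ι β
    ι[1-β] = trans (+-homo 1ℚ _) (+-congˡ (-‿homo β))

  triple-root-rational : ∀ {a b c x₁ x₂ x₃} → AreRootsOf K ι (cubic a b c) x₁ x₂ x₃ →
                         x₂ ≈ x₁ → x₃ ≈ x₁ → ι (⅓ ℚ.* ℚ.- a) ≈ x₁
  triple-root-rational {a} {x₁ = x₁} {x₂} {x₃} roots x₂≈x₁ x₃≈x₁ = begin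
    ι (⅓ ℚ.* ℚ.- a)          ≈⟨ *-homo ⅓ _ ⟩
    ι ⅓ * ι (ℚ.- a)          ≈⟨ *-congˡ (-‿homo a) ⟩
    ι ⅓ * - ι a              ≈⟨ *-congˡ (roots-sum roots) ⟨
    ι ⅓ * (x₁ + x₂ + x₃)     ≈⟨ *-congˡ (+-cong (+-congˡ x₂≈x₁) x₃≈x₁) ⟩
    ι ⅓ * (x₁ + x₁ + x₁)     ≈⟨ solve 1 (λ x → con ⅓ :* (x :+ x :+ x) := x) ≈-refl x₁ ⟩
    x₁                       ∎

  affine-3-cycle-rational : ∀ {a b c x₁ x₂ x₃ β γ} → AreRootsOf K ι (cubic a b c) x₁ x₂ x₃ →
    eval K ι (quadratic 0ℚ β γ) x₁ ≈ x₂ →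
    eval K ι (quadratic 0ℚ β γ) x₂ ≈ x₃ →
    eval K ι (quadratic 0ℚ β γ) x₃ ≈ x₁ →
    ∃ λ r → ι r ≈ x₁
  affine-3-cycle-rational {x₁ = x₁} {β = β} {γ} roots q₁ q₂ q₃ with 1ℚ ℚ.≟ β
  ... | no 1≢β = _ , ι-divide (1ℚ ℚ.- β) {{ℚ.≢-nonZero (1≢β ∘ p-q≡0⇒p≡q 1ℚ β)}} linear
    where
    linear : ι (1ℚ ℚ.- β) * x₁ ≈ ι γ
    linear = affine-3-cycle⇒linear (affine-step q₁) (affine-step q₂) (affine-step q₃)
  ... | yes refl = _ , triple-root-rational roots (fixed q₁) (trans (fixed q₂) (fixed q₁))
    where
    linear : ι (1ℚ ℚ.- 1ℚ) * x₁ ≈ ι γ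
    linear = affine-3-cycle⇒linear (affine-step q₁) (affine-step q₂) (affine-step q₃)
    γ≈0 : ι γ ≈ 0#
    γ≈0 = begin
      ι γ                  ≈⟨ linear ⟨
      ι (1ℚ ℚ.- 1ℚ) * x₁   ≈⟨ *-congʳ 0#-homo ⟩
      0# * x₁              ≈⟨ zeroˡ x₁ ⟩
      0#                   ∎
    fixed : ∀ {x y} → eval K ι (quadratic 0ℚ 1ℚ γ) x ≈ y → y ≈ x
    fixed {x} {y} q = begin
      y                ≈⟨ affine-step q ⟩
      ι γ + x * ι 1ℚ   ≈⟨ +-cong γ≈0 (*-congˡ 1#-homo) ⟩
      0# + x * 1#      ≈⟨ +-identityˡ _ ⟩
      x * 1#           ≈⟨ *-identityʳ x ⟩
      x                ∎

  rational-root⇒¬irreducible : ∀ {a b c x₁ x₂ x₃ r} → 1# ≉ 0# →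
    AreRootsOf K ι (cubic a b c) x₁ x₂ x₃ → ι r ≈ x₁ → ¬ Irreducible (cubic a b c)
  rational-root⇒¬irreducible {a} {b} {c} {x₁} {x₂} {x₃} {r} 1≉0 roots ιr≈x₁ =
    root⇒¬irreducible r (ι≈0⇒≡0 1≉0 _ (begin
      ι (evalℚ (cubic a b c) r)              ≈⟨ eval-ι (cubic a b c) r ⟨
      eval K ι (cubic a b c) (ι r)           ≈⟨ roots (ι r) ⟩
      (ι r - x₁) * (ι r - x₂) * (ι r - x₃)   ≈⟨ *-congʳ (*-congʳ (x≈y⇒x∙y⁻¹≈ε ιr≈x₁)) ⟩
      0# * (ι r - x₂) * (ι r - x₃)           ≈⟨ trans (*-congʳ (zeroˡ _)) (zeroˡ _) ⟩
      0#                                     ∎))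

mainTheorem2 : ∀ {c ℓ} (K : CommutativeRing c ℓ) → IsField K →
    (ι : ℚ → CommutativeRing.Carrier K) → IsℚEmbedding K ι →
    (a b c₀ : ℚ) → IsCubicGalois a b c₀ →
    (x₁ x₂ x₃ : CommutativeRing.Carrier K) → AreRootsOf K ι (cubic a b c₀) x₁ x₂ x₃ →
    (α β γ : ℚ) →
    CommutativeRing._≈_ K (eval K ι (quadratic α β γ) x₁) x₂ →
    CommutativeRing._≈_ K (eval K ι (quadratic α β γ) x₂) x₃ →
    CommutativeRing._≈_ K (eval K ι (quadratic α β γ) x₃) x₁ →
    α ≢ 0ℚ
mainTheorem2 K (1≉0 , _) ι ι-hom a b c₀ (irreducible , _) x₁ x₂ x₃ roots α β γ q₁ q₂ q₃ refl =
  let r , ιr≈x₁ = affine-3-cycle-rational K ι-hom roots q₁ q₂ q₃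
  in  rational-root⇒¬irreducible K ι-hom 1≉0 roots ιr≈x₁ irreducible
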